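{- Let $f(D)$ be a delta operator with associated graded sequence $(p_a^\alpha(x))$. Then for every integer $a$ the following series converges and $$f^{(-1)}(D)^a=\sum_k\frac{\langle (1)\mid D^a p_k^{(1)}(x)\rangle}{\lfloor k\rceil!}D^k.$$
   Context: Setting (discrete case of the logarithmic umbral calculus). For $a\in\mathbb{Z}$ let $\lfloor a\rceil=a$ if $a\neq0$, $\lfloor 0\rceil=1$; $\lfloor a\rceil!=a!$ for $a\ge0$, $\lfloor a\rceil!=(-1)^{ -a-1}/(-a-1)!$ for $a<0$. Harmonic logarithms $\lambda_a^\alpha(x)$ ($a\in\mathbb{Z}$, $\alpha$ a logarithmic index): $\lambda_a^{(0)}=x^a$ for $a\ge0$, $0$ for $a<0$; $\lambda_a^{(1)}=x^a(\log x-H_a)$ for $a\ge0$, $x^a$ for $a<0$; higher indices involve iterated logarithms. $\mathcal{I}^\alpha$: formal series $\sum_{b\le N}c_b\lambda_b^\alpha$. $D\lambda_a^\alpha=\lfloor a\rceil\lambda_{a-1}^\alpha$; Artinian operators $\sum_{a\ge k}c_aD^a$ act via $D^b\lambda_a^\alpha=\frac{\lfloor a\rceil!}{\lfloor a-b\rceil!}\lambda_{a-b}^\alpha$; delta operators are $\sum_{a\ge1}c_aD^a$ with $c_1\ne0$; $f^{(-1)}$ is the compositional inverse of $f$. $\langle\alpha\mid p\rangle$ = coefficient of $\lambda_0^\alpha$ in $p$. A graded sequence is a regular family $(p_a^\alpha)$, $p_a^\alpha\in\mathcal{I}^\alpha$ of degree $a$ (coefficients independent of $\alpha\ne(0)$;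 $p_a^{(0)}$ obtained from $p_a^{(1)}$ by $\lambda_b^{(1)}\mapsto\lambda_b^{(0)}$). The associated graded sequence of a delta operator $f(D)$ is the unique graded sequence with $\langle\alpha\mid p_0^\alpha\rangle=1$, $\langle\alpha\mid p_a^\alpha\rangle=0$ ($a\ne0$), $f(D)p_a^\alpha=\lfloor a\rceil p_{a-1}^\alpha$. -}

module Defs where

open import Level using (_⊔_) renaming (suc to lsuc)
open import Algebra.Bundles using (CommutativeRing)
open import Data.Nat as ℕ using (ℕ; zero; suc; _∸_; _≡ᵇ_; _≤ᵇ_)
open import Data.Integer as ℤ using (ℤ; +_; -[1+_])
open import Data.Bool using (if_then_else_)
open import Data.Product using (_×_)
open import Relation.Nullary using (¬_)
open import Relation.Binary.PropositionalEquality using (_≡_)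

ι : ∀ {c ℓ} (R : CommutativeRing c ℓ) → ℕ → CommutativeRing.Carrier R
ι R zero    = CommutativeRing.0# R
ι R (suc n) = CommutativeRing._+_ R (CommutativeRing.1# R) (ι R n)

-- A commutative ring is a field of characteristic zero:
-- a total inverse map which inverts every nonzero element (value at 0 irrelevant),
-- and ι (n+1) ≠ 0 for all n.
record IsCharZeroField {c ℓ} (R : CommutativeRing c ℓ) : Set (c ⊔ ℓ) where
  open CommutativeRing R
  field
    _⁻¹       : Carrier → Carrier
    ⁻¹-inverse : ∀ x → ¬ (x ≈ 0#) → (x * (x ⁻¹)) ≈ 1#
    charZero  : ∀ n → ¬ (ι R (suc n) ≈ 0#)

module Umbral {c ℓ} (R : CommutativeRing c ℓ) (F : IsCharZeroField R) where
  open CommutativeRing R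
  open IsCharZeroField F

  sumTo : (ℕ → Carrier) → ℕ → Carrier
  sumTo f zero    = 0#
  sumTo f (suc n) = sumTo f n + f n

  prodTo : (ℕ → Carrier) → ℕ → Carrier
  prodTo f zero    = 1#
  prodTo f (suc n) = prodTo f n * f n

  fl : ℤ → Carrier
  fl (+ zero)   = 1#
  fl (+ suc n)  = ι R (suc n)
  fl -[1+ n ]   = - ι R (suc n)

  natFact : ℕ → Carrier
  natFact n = prodTo (λ i → ι R (suc i)) n

  signPow : ℕ → Carrier
  signPow zero    = 1#
  signPow (suc n) = - signPow n

  fact : ℤ → Carrier
  fact (+ n)    = natFact n
  fact -[1+ n ] = signPow n * (natFact n) ⁻¹

  -- Elements of I^(1): a formal series Σ_{b ≤ N} d_b λ_b^(1) is represented
  -- by its coefficient function d : ℤ → Carrier (d b = coefficient of λ_b^(1)).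

  -- coefficient of λ_m^(1) in D^b (Σ_c d_c λ_c^(1)), using
  -- D^b λ_c = ⌊c⌉!/⌊c-b⌉! λ_{c-b}   (b ∈ ℤ)
  Dpow : ℤ → (ℤ → Carrier) → ℤ → Carrier
  Dpow b d m = d (m ℤ.+ b) * (fact (m ℤ.+ b) * (fact m) ⁻¹)

  -- coefficient of λ_m^(1) in (Σ_{j≥0} f_j D^j) d, where d has support ≤ N
  -- (the terms with j > ∣N - m∣ vanish in that case, so the sum is finite)
  applyOp : (ℕ → Carrier) → ℤ → (ℤ → Carrier) → ℤ → Carrier
  applyOp f N d m = sumTo (λ j → f j * Dpow (+ j) d m) (suc ℤ.∣ N ℤ.- m ∣)

  bracket : (ℤ → Carrier) → Carrier
  bracket d = d (+ 0)

  -- p : ℤ → (ℤ → Carrier), p a = p_a^(1), is the associated graded sequence of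
  -- the delta operator f(D) = Σ_{j ≥ 1} f_j D^j
  IsAssocGradedSeq : (ℕ → Carrier) → (ℤ → ℤ → Carrier) → Set ℓ
  IsAssocGradedSeq f p =
      (∀ a b → a ℤ.< b → p a b ≈ 0#)
    × (∀ a → ¬ (p a a ≈ 0#))
    × (bracket (p (+ 0)) ≈ 1#)
    × (∀ a → ¬ (a ≡ + 0) → bracket (p a) ≈ 0#)
    × (∀ a m → applyOp f a (p a) m ≈ fl a * p (a ℤ.- + 1) m)

  -- formal power series  h : ℕ → Carrier  (h n = coefficient of t^n)

  mulPS : (ℕ → Carrier) → (ℕ → Carrier) → ℕ → Carrier
  mulPS u v n = sumTo (λ i → u i * v (n ∸ i)) (suc n)

  onePS : ℕ → Carrier
  onePS n = if n ≡ᵇ 0 then 1# else 0#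

  XPS : ℕ → Carrier
  XPS n = if n ≡ᵇ 1 then 1# else 0#

  powPS : (ℕ → Carrier) → ℕ → ℕ → Carrier
  powPS u zero    = onePS
  powPS u (suc n) = mulPS u (powPS u n)

  -- composition u(v(t)) for v with zero constant term
  compPS : (ℕ → Carrier) → (ℕ → Carrier) → ℕ → Carrier
  compPS u v m = sumTo (λ n → u n * powPS v n m) (suc m)

  IsCompInverse : (ℕ → Carrier) → (ℕ → Carrier) → Set ℓ
  IsCompInverse f g =
    (g 0 ≈ 0#) × (∀ m → compPS f g m ≈ XPS m) × (∀ m → compPS g f m ≈ XPS m)

  invUpTo : (ℕ → Carrier) → ℕ → ℕ → Carrier
  invUpTo u zero k = if k ≡ᵇ 0 then (u 0) ⁻¹ else 0#
  invUpTo u (suc m) k =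
    if k ≤ᵇ m then invUpTo u m k
    else if k ≡ᵇ suc m
      then (- ((u 0) ⁻¹)) * sumTo (λ j → u (suc j) * invUpTo u m (m ∸ j)) (suc m)
      else 0#

  invPS : (ℕ → Carrier) → ℕ → Carrier
  invPS u k = invUpTo u k k

  -- Laurent series / operators Σ_k h_k D^k represented by h : ℤ → Carrier

  embed : (ℕ → Carrier) → ℤ → Carrier
  embed h (+ m)    = h m
  embed h -[1+ _ ] = 0#

  -- g^a for a ∈ ℤ, g a power series with g_0 = 0, g_1 ≠ 0:
  --   a = n ≥ 0 : ordinary power;
  --   a = -(n+1): g = t·u,  g^a = t^{-(n+1)} · (u⁻¹)^{n+1}
  gpow : (ℕ → Carrier) → ℤ → ℤ → Carrier
  gpow g (+ n)    k = embed (powPS g n) k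
  gpow g -[1+ n ] k = embed (powPS (invPS (λ i → g (suc i))) (suc n)) (k ℤ.+ + suc n)

  rhsCoeff : (ℤ → ℤ → Carrier) → ℤ → ℤ → Carrier
  rhsCoeff p a k = bracket (Dpow a (p k)) * (fact k) ⁻¹

{-# OPTIONS --safe #-}
-- Write X k m for the coefficient of D^k in f⁻¹(D)^m, and Y k m for ⟨(1) | D^m p_k⟩ / ⌊k⌉!.
-- Both tables vanish for k < m, both have the column m = 0 equal to δ_{k0}, and both satisfy
--   Σ_j f_j T(k, m + j) = T(k - 1, m):
-- for Y this is f(D) p_k = ⌊k⌉ p_{k-1}; for X it is the coefficient of X^k in f(g) g^m = X g^m,
-- g = f⁻¹, where g^m = X^m u^m with u = g/X an invertible power series, also for negative m.
-- Because f_0 = 0 and f_1 ≠ 0, on the diagonal k = m + n the recurrence ties T(m + 1 + n, m + 1)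
-- to T(m + n, m) modulo entries of nearer diagonals; starting from the common value at m = 0,
-- induction on n shows that the two tables coincide.
module Submission where

open import Defs
open import Algebra.Bundles using (CommutativeRing; CommutativeMonoid)
open import Data.Bool using (Bool; true; false; T; if_then_else_)
open import Data.Nat as ℕ using (ℕ; zero; suc; _∸_; z≤n; s≤s)
import Data.Nat.Properties as ℕₚ
open import Data.Nat.Induction using (<-rec)
open import Data.Integer as ℤ using (ℤ; +_; -[1+_]; _<_)
import Data.Integer.Properties as ℤₚ
open import Data.Integer.Tactic.RingSolver using (solve-∀)
open import Data.Product using (_×_; _,_; ∃-syntax)
open import Data.Sum using (_⊎_; inj₁; inj₂)
open import Relation.Nullary using (¬_; yes; no; contradiction)
open import Relation.Binary.PropositionalEquality as ≡ using (_≡_; cong)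

m+n-m≡n : ∀ m n → m ℤ.+ n ℤ.- m ≡ n
m+n-m≡n = solve-∀

m+[n-m]≡n : ∀ m n → m ℤ.+ (n ℤ.- m) ≡ n
m+[n-m]≡n = solve-∀

m+[1+n]-1≡m+n : ∀ m n → m ℤ.+ (+ 1 ℤ.+ n) ℤ.- + 1 ≡ m ℤ.+ n
m+[1+n]-1≡m+n = solve-∀

m+[1+n]≡[1+m]+n : ∀ m n → m ℤ.+ (+ 1 ℤ.+ n) ≡ (+ 1 ℤ.+ m) ℤ.+ n
m+[1+n]≡[1+m]+n = solve-∀

m+0-1≡pred[m] : ∀ m → m ℤ.+ + 0 ℤ.- + 1 ≡ ℤ.- + 1 ℤ.+ m
m+0-1≡pred[m] = solve-∀

<⊎≡+ : ∀ k m → k < m ⊎ ∃[ n ] k ≡ m ℤ.+ + n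
<⊎≡+ k m with m ℤₚ.≤? k
... | no  m≰k = inj₁ (ℤₚ.≰⇒> m≰k)
... | yes m≤k = inj₂ (ℤ.∣ k ℤ.- m ∣ , ≡.sym (≡.trans
      (cong (λ i → m ℤ.+ i) (ℤₚ.0≤i⇒+∣i∣≡i (ℤₚ.i≤j⇒0≤j-i m≤k))) (m+[n-m]≡n m k)))

if-true : ∀ {a} {A : Set a} {b : Bool} {x y : A} → T b → (if b then x else y) ≡ x
if-true {b = true} _ = ≡.refl

if-false : ∀ {a} {A : Set a} {b : Bool} {x y : A} → ¬ T b → (if b then x else y) ≡ y
if-false {b = false} _ = ≡.refl
if-false {b = true}  ¬t = contradiction _ ¬t

module IntegerPowers {a ℓ} (M : CommutativeMonoid a ℓ) where
  open CommutativeMonoid M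
  import Algebra.Properties.Monoid.Mult monoid as Mult
  open import Algebra.Properties.CommutativeSemigroup commutativeSemigroup using (interchange)
  open import Relation.Binary.Reasoning.Setoid setoid

  infixr 8 _^_
  _^_ : Carrier → ℕ → Carrier
  x ^ n = n Mult.× x

  ^-congʳ : ∀ x {m n} → m ≡ n → x ^ m ≈ x ^ n
  ^-congʳ x = Mult.×-congˡ

  ^-homo-+ : ∀ x m n → x ^ (m ℕ.+ n) ≈ x ^ m ∙ x ^ n
  ^-homo-+ x = Mult.×-homo-+ x

  module _ {u v : Carrier} (u∙v≈ε : u ∙ v ≈ ε) where

    powℤ : ℤ → Carrier
    powℤ (+ n)    = u ^ n
    powℤ -[1+ n ] = v ^ suc n

    u^[i+n]∙v^i≈u^n : ∀ i n → u ^ (i ℕ.+ n) ∙ v ^ i ≈ u ^ n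
    u^[i+n]∙v^i≈u^n zero    n = identityʳ (u ^ n)
    u^[i+n]∙v^i≈u^n (suc i) n = begin
      (u ∙ u ^ (i ℕ.+ n)) ∙ (v ∙ v ^ i) ≈⟨ interchange u _ v _ ⟩
      (u ∙ v) ∙ (u ^ (i ℕ.+ n) ∙ v ^ i) ≈⟨ ∙-cong u∙v≈ε (u^[i+n]∙v^i≈u^n i n) ⟩
      ε ∙ u ^ n                         ≈⟨ identityˡ (u ^ n) ⟩
      u ^ n                             ∎

    u^i∙v^[i+n]≈v^n : ∀ i n → u ^ i ∙ v ^ (i ℕ.+ n) ≈ v ^ n
    u^i∙v^[i+n]≈v^n zero    n = identityˡ (v ^ n)
    u^i∙v^[i+n]≈v^n (suc i) n = begin
      (u ∙ u ^ i) ∙ (v ∙ v ^ (i ℕ.+ n)) ≈⟨ interchange u _ v _ ⟩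
      (u ∙ v) ∙ (u ^ i ∙ v ^ (i ℕ.+ n)) ≈⟨ ∙-cong u∙v≈ε (u^i∙v^[i+n]≈v^n i n) ⟩
      ε ∙ v ^ n                         ≈⟨ identityˡ (v ^ n) ⟩
      v ^ n                             ∎

    powℤ-+ : ∀ m j → powℤ (m ℤ.+ + j) ≈ u ^ j ∙ powℤ m
    powℤ-+ (+ n) j = trans (^-congʳ u (ℕₚ.+-comm n j)) (^-homo-+ u j n)
    powℤ-+ -[1+ n ] j with j ℕₚ.≤? n
    ... | yes j≤n = begin
      powℤ (j ℤ.⊖ suc n)              ≡⟨ cong powℤ (≡.trans (ℤₚ.⊖-< (s≤s j≤n)) (cong (λ i → ℤ.- (+ i)) (ℕₚ.+-∸-assoc 1 j≤n))) ⟩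
      v ^ suc (n ∸ j)                 ≈⟨ u^i∙v^[i+n]≈v^n j (suc (n ∸ j)) ⟨
      u ^ j ∙ v ^ (j ℕ.+ suc (n ∸ j)) ≈⟨ ∙-congˡ (^-congʳ v (≡.trans (ℕₚ.+-suc j _) (cong suc (ℕₚ.m+[n∸m]≡n j≤n)))) ⟩
      u ^ j ∙ v ^ suc n               ∎
    ... | no j≰n = begin
      powℤ (j ℤ.⊖ suc n)                   ≡⟨ cong powℤ (ℤₚ.⊖-≥ n<j) ⟩
      u ^ (j ∸ suc n)                      ≈⟨ u^[i+n]∙v^i≈u^n (suc n) (j ∸ suc n) ⟨
      u ^ (suc n ℕ.+ (j ∸ suc n)) ∙ v ^ suc n ≈⟨ ∙-congʳ (^-congʳ u (ℕₚ.m+[n∸m]≡n n<j)) ⟩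
      u ^ j ∙ v ^ suc n                    ∎
      where n<j = ℕₚ.≰⇒> j≰n

module UmbralProperties {c ℓ} (R : CommutativeRing c ℓ) (F : IsCharZeroField R) where
  open CommutativeRing R hiding (zero)
  open Umbral R F
  open IsCharZeroField F
  open import Algebra.Properties.Ring ring
    using (-0#≈0#; -‿distribˡ-*; -‿distribʳ-*; -‿involutive; -‿+-comm; x[y-z]≈xy-xz)
    renaming (x∙y⁻¹≈ε⇒x≈y to x-y≈0⇒x≈y; x≈y⇒x∙y⁻¹≈ε to x≈y⇒x-y≈0)
  open import Algebra.Properties.CommutativeSemigroup +-commutativeSemigroup
    using () renaming (interchange to +-interchange)
  open import Algebra.Properties.CommutativeSemigroup *-commutativeSemigroup
    using () renaming ( interchange to *-interchange ; x∙yz≈y∙xz to x*[y*z]≈y*[x*z]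
                      ; xy∙z≈zx∙y to [x*y]*z≈[z*x]*y ; xy∙z≈y∙xz to [x*y]*z≈y*[x*z] )
  open import Relation.Binary.Reasoning.Setoid setoid

  1≉0 : 1# ≉ 0#
  1≉0 1≈0 = charZero 0 (trans (+-identityʳ 1#) 1≈0)

  ⁻¹-inverseˡ : ∀ {x} → x ≉ 0# → x ⁻¹ * x ≈ 1#
  ⁻¹-inverseˡ {x} x≉0 = trans (*-comm _ x) (⁻¹-inverse x x≉0)

  x≉0∧x*y≈0⇒y≈0 : ∀ {x y} → x ≉ 0# → x * y ≈ 0# → y ≈ 0#
  x≉0∧x*y≈0⇒y≈0 {x} {y} x≉0 x*y≈0 = begin
    y              ≈⟨ *-identityˡ y ⟨
    1# * y         ≈⟨ *-congʳ (⁻¹-inverseˡ x≉0) ⟨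
    (x ⁻¹ * x) * y ≈⟨ *-assoc _ x y ⟩
    x ⁻¹ * (x * y) ≈⟨ *-congˡ x*y≈0 ⟩
    x ⁻¹ * 0#      ≈⟨ zeroʳ _ ⟩
    0#             ∎

  *-≉0 : ∀ {x y} → x ≉ 0# → y ≉ 0# → x * y ≉ 0#
  *-≉0 x≉0 y≉0 x*y≈0 = y≉0 (x≉0∧x*y≈0⇒y≈0 x≉0 x*y≈0)

  ⁻¹-≉0 : ∀ {x} → x ≉ 0# → x ⁻¹ ≉ 0#
  ⁻¹-≉0 {x} x≉0 x⁻¹≈0 = 1≉0 (trans (sym (⁻¹-inverse x x≉0)) (trans (*-congˡ x⁻¹≈0) (zeroʳ x)))

  -‿≉0 : ∀ {x} → x ≉ 0# → - x ≉ 0#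
  -‿≉0 {x} x≉0 -x≈0 = x≉0 (trans (sym (-‿involutive x)) (trans (-‿cong -x≈0) -0#≈0#))

  ⁻¹-unique : ∀ {x y} → x ≉ 0# → y * x ≈ 1# → y ≈ x ⁻¹
  ⁻¹-unique {x} {y} x≉0 y*x≈1 = begin
    y              ≈⟨ *-identityʳ y ⟨
    y * 1#         ≈⟨ *-congˡ (⁻¹-inverse x x≉0) ⟨
    y * (x * x ⁻¹) ≈⟨ *-assoc y x _ ⟨
    (y * x) * x ⁻¹ ≈⟨ *-congʳ y*x≈1 ⟩
    1# * x ⁻¹      ≈⟨ *-identityˡ _ ⟩
    x ⁻¹           ∎

  1⁻¹≈1 : 1# ⁻¹ ≈ 1#
  1⁻¹≈1 = sym (⁻¹-unique 1≉0 (*-identityˡ 1#))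

  x*y⁻¹*[y*z]≈x*z : ∀ x {y} z → y ≉ 0# → (x * y ⁻¹) * (y * z) ≈ x * z
  x*y⁻¹*[y*z]≈x*z x {y} z y≉0 = begin
    (x * y ⁻¹) * (y * z) ≈⟨ *-assoc x _ _ ⟩
    x * (y ⁻¹ * (y * z)) ≈⟨ *-congˡ (*-assoc _ y z) ⟨
    x * ((y ⁻¹ * y) * z) ≈⟨ *-congˡ (*-congʳ (⁻¹-inverseˡ y≉0)) ⟩
    x * (1# * z)         ≈⟨ *-congˡ (*-identityˡ z) ⟩
    x * z                ∎

  sumTo-cong< : ∀ {f g : ℕ → Carrier} n → (∀ i → i ℕ.< n → f i ≈ g i) → sumTo f n ≈ sumTo g n
  sumTo-cong< zero    f≈g = refl
  sumTo-cong< (suc n) f≈g = +-cong (sumTo-cong< n (λ i i<n → f≈g i (ℕₚ.m<n⇒m<1+n i<n))) (f≈g n ℕₚ.≤-refl)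

  sumTo-cong : ∀ {f g : ℕ → Carrier} n → (∀ i → f i ≈ g i) → sumTo f n ≈ sumTo g n
  sumTo-cong n f≈g = sumTo-cong< n (λ i _ → f≈g i)

  sumTo-≈0 : ∀ {f : ℕ → Carrier} n → (∀ i → i ℕ.< n → f i ≈ 0#) → sumTo f n ≈ 0#
  sumTo-≈0 zero    f≈0 = refl
  sumTo-≈0 (suc n) f≈0 = trans (+-cong (sumTo-≈0 n (λ i i<n → f≈0 i (ℕₚ.m<n⇒m<1+n i<n))) (f≈0 n ℕₚ.≤-refl)) (+-identityʳ 0#)

  sumTo-+ : ∀ (f g : ℕ → Carrier) n → sumTo (λ i → f i + g i) n ≈ sumTo f n + sumTo g n
  sumTo-+ f g zero    = sym (+-identityʳ 0#)
  sumTo-+ f g (suc n) = trans (+-congʳ (sumTo-+ f g n)) (+-interchange _ _ _ _)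

  sumTo-difference : ∀ (f g : ℕ → Carrier) n → sumTo (λ i → f i - g i) n ≈ sumTo f n - sumTo g n
  sumTo-difference f g n = begin
    sumTo (λ i → f i - g i) n         ≈⟨ sumTo-+ f (λ i → - g i) n ⟩
    sumTo f n + sumTo (λ i → - g i) n ≈⟨ +-congˡ (-sumTo g n) ⟩
    sumTo f n - sumTo g n             ∎
    where
    -sumTo : ∀ (g : ℕ → Carrier) n → sumTo (λ i → - g i) n ≈ - sumTo g n
    -sumTo g zero    = sym -0#≈0#
    -sumTo g (suc n) = trans (+-congʳ (-sumTo g n)) (-‿+-comm _ _)

  *-distribˡ-sumTo : ∀ x (f : ℕ → Carrier) n → x * sumTo f n ≈ sumTo (λ i → x * f i) n
  *-distribˡ-sumTo x f zero    = zeroʳ x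
  *-distribˡ-sumTo x f (suc n) = trans (distribˡ x _ _) (+-congʳ (*-distribˡ-sumTo x f n))

  *-distribʳ-sumTo : ∀ x (f : ℕ → Carrier) n → sumTo f n * x ≈ sumTo (λ i → f i * x) n
  *-distribʳ-sumTo x f n = trans (*-comm _ x) (trans (*-distribˡ-sumTo x f n) (sumTo-cong n (λ i → *-comm x (f i))))

  sumTo-split : ∀ (f : ℕ → Carrier) m n → sumTo f (m ℕ.+ n) ≈ sumTo f m + sumTo (λ i → f (m ℕ.+ i)) n
  sumTo-split f m zero    rewrite ℕₚ.+-identityʳ m = sym (+-identityʳ _)
  sumTo-split f m (suc n) rewrite ℕₚ.+-suc m n     = trans (+-congʳ (sumTo-split f m n)) (+-assoc _ _ _)

  sumTo-suc : ∀ (f : ℕ → Carrier) n → sumTo f (suc n) ≈ f 0 + sumTo (λ i → f (suc i)) n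
  sumTo-suc f n = trans (sumTo-split f 1 n) (+-congʳ (+-identityˡ (f 0)))

  sumTo≈term₁ : ∀ {h : ℕ → Carrier} n → h 0 ≈ 0# → (∀ i → i ℕ.< n → h (2 ℕ.+ i) ≈ 0#) → sumTo h (2 ℕ.+ n) ≈ h 1
  sumTo≈term₁ {h} n h₀≈0 h[2+i]≈0 = begin
    sumTo h (2 ℕ.+ n)                          ≈⟨ sumTo-suc h (suc n) ⟩
    h 0 + sumTo (λ i → h (suc i)) (suc n)      ≈⟨ +-congˡ (sumTo-suc (λ i → h (suc i)) n) ⟩
    h 0 + (h 1 + sumTo (λ i → h (2 ℕ.+ i)) n)  ≈⟨ +-cong h₀≈0 (+-congˡ (sumTo-≈0 n h[2+i]≈0)) ⟩
    0# + (h 1 + 0#)                            ≈⟨ trans (+-identityˡ _) (+-identityʳ _) ⟩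
    h 1                                        ∎

  sumTo-reverse : ∀ (f : ℕ → Carrier) n → sumTo f n ≈ sumTo (λ i → f (n ∸ suc i)) n
  sumTo-reverse f zero    = refl
  sumTo-reverse f (suc n) = begin
    sumTo f n + f n                         ≈⟨ +-congʳ (sumTo-reverse f n) ⟩
    sumTo (λ i → f (n ∸ suc i)) n + f n     ≈⟨ +-comm _ _ ⟩
    f n + sumTo (λ i → f (n ∸ suc i)) n     ≈⟨ sumTo-suc (λ i → f (suc n ∸ suc i)) n ⟨
    sumTo (λ i → f (suc n ∸ suc i)) (suc n) ∎

  sumTo-comm : ∀ (a : ℕ → ℕ → Carrier) m n →
               sumTo (λ i → sumTo (a i) n) m ≈ sumTo (λ j → sumTo (λ i → a i j) m) n
  sumTo-comm a zero    n = sym (sumTo-≈0 n (λ _ _ → refl))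
  sumTo-comm a (suc m) n = trans (+-congʳ (sumTo-comm a m n)) (sym (sumTo-+ _ (a m) n))

  sumTo-extend : ∀ {f g : ℕ → Carrier} {m n} → m ℕ.≤ n → (∀ i → i ℕ.≤ m → f i ≈ g i) →
                 (∀ i → m ℕ.< i → g i ≈ 0#) → sumTo f (suc m) ≈ sumTo g (suc n)
  sumTo-extend {f} {g} {m} {n} m≤n f≈g g≈0 = begin
    sumTo f (suc m)
      ≈⟨ sumTo-cong< (suc m) (λ i i<1+m → f≈g i (ℕₚ.≤-pred i<1+m)) ⟩
    sumTo g (suc m)
      ≈⟨ +-identityʳ _ ⟨
    sumTo g (suc m) + 0#
      ≈⟨ +-congˡ (sumTo-≈0 (n ∸ m) (λ i _ → g≈0 (suc m ℕ.+ i) (s≤s (ℕₚ.m≤m+n m i)))) ⟨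
    sumTo g (suc m) + sumTo (λ i → g (suc m ℕ.+ i)) (n ∸ m)
      ≈⟨ sumTo-split g (suc m) (n ∸ m) ⟨
    sumTo g (suc m ℕ.+ (n ∸ m))
      ≡⟨ cong (λ k → sumTo g (suc k)) (ℕₚ.m+[n∸m]≡n m≤n) ⟩
    sumTo g (suc n) ∎

  sumTo-triangle : ∀ (a : ℕ → ℕ → Carrier) n →
                   sumTo (λ i → sumTo (a i) (suc (n ∸ i))) (suc n) ≈
                   sumTo (λ j → sumTo (λ i → a i j) (suc (n ∸ j))) (suc n)
  sumTo-triangle a n = begin
    sumTo (λ i → sumTo (a i) (suc (n ∸ i))) (suc n)
      ≈⟨ sumTo-cong< (suc n) (λ i i<1+n →
           sumTo-extend (ℕₚ.m∸n≤m n i) (row-inside i (ℕₚ.≤-pred i<1+n)) (row-outside i)) ⟩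
    sumTo (λ i → sumTo (cut i) (suc n)) (suc n)
      ≈⟨ sumTo-comm cut (suc n) (suc n) ⟩
    sumTo (λ j → sumTo (λ i → cut i j) (suc n)) (suc n)
      ≈⟨ sumTo-cong< (suc n) (λ j j<1+n →
           sym (sumTo-extend (ℕₚ.m∸n≤m n j) (column-inside j (ℕₚ.≤-pred j<1+n)) (column-outside j))) ⟩
    sumTo (λ j → sumTo (λ i → a i j) (suc (n ∸ j))) (suc n) ∎
    where
    cut : ℕ → ℕ → Carrier
    cut i j with i ℕ.+ j ℕₚ.≤? n
    ... | yes _ = a i j
    ... | no  _ = 0#

    cut-inside : ∀ i j → i ℕ.+ j ℕ.≤ n → a i j ≈ cut i j
    cut-inside i j i+j≤n with i ℕ.+ j ℕₚ.≤? n
    ... | yes _     = refl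
    ... | no  i+j≰n = contradiction i+j≤n i+j≰n

    cut-outside : ∀ i j → ¬ i ℕ.+ j ℕ.≤ n → cut i j ≈ 0#
    cut-outside i j i+j≰n with i ℕ.+ j ℕₚ.≤? n
    ... | yes i+j≤n = contradiction i+j≤n i+j≰n
    ... | no  _     = refl

    row-inside : ∀ i → i ℕ.≤ n → ∀ j → j ℕ.≤ n ∸ i → a i j ≈ cut i j
    row-inside i i≤n j j≤n-i = cut-inside i j (≡.subst (ℕ._≤ n) (ℕₚ.+-comm j i) (ℕₚ.m≤o∸n⇒m+n≤o j i≤n j≤n-i))

    column-inside : ∀ j → j ℕ.≤ n → ∀ i → i ℕ.≤ n ∸ j → a i j ≈ cut i j
    column-inside j j≤n i i≤n-j = cut-inside i j (ℕₚ.m≤o∸n⇒m+n≤o i j≤n i≤n-j)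

    row-outside : ∀ i j → n ∸ i ℕ.< j → cut i j ≈ 0#
    row-outside i j n-i<j = cut-outside i j (λ i+j≤n →
      ℕₚ.<⇒≱ n-i<j (ℕₚ.m+n≤o⇒m≤o∸n j (≡.subst (ℕ._≤ n) (ℕₚ.+-comm i j) i+j≤n)))

    column-outside : ∀ j i → n ∸ j ℕ.< i → cut i j ≈ 0#
    column-outside j i n-j<i = cut-outside i j (λ i+j≤n → ℕₚ.<⇒≱ n-j<i (ℕₚ.m+n≤o⇒m≤o∸n i i+j≤n))

  infix 4 _≐_
  _≐_ : (ℕ → Carrier) → (ℕ → Carrier) → Set ℓ
  u ≐ v = ∀ n → u n ≈ v n

  mulPS-cong : ∀ {u u′ v v′} → u ≐ u′ → v ≐ v′ → mulPS u v ≐ mulPS u′ v′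
  mulPS-cong u≐u′ v≐v′ n = sumTo-cong (suc n) (λ i → *-cong (u≐u′ i) (v≐v′ (n ∸ i)))

  mulPS-comm : ∀ u v → mulPS u v ≐ mulPS v u
  mulPS-comm u v n = begin
    sumTo (λ i → u i * v (n ∸ i)) (suc n)
      ≈⟨ sumTo-reverse _ (suc n) ⟩
    sumTo (λ i → u (n ∸ i) * v (n ∸ (n ∸ i))) (suc n)
      ≈⟨ sumTo-cong< (suc n) (λ i i<1+n →
           trans (*-comm _ _) (*-congʳ (reflexive (cong v (ℕₚ.m∸[m∸n]≡n (ℕₚ.≤-pred i<1+n)))))) ⟩
    sumTo (λ i → v i * u (n ∸ i)) (suc n) ∎

  mulPS-lcomm : ∀ u v w → mulPS u (mulPS v w) ≐ mulPS v (mulPS u w)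
  mulPS-lcomm u v w n = begin
    sumTo (λ i → u i * sumTo (λ j → v j * w (n ∸ i ∸ j)) (suc (n ∸ i))) (suc n)
      ≈⟨ sumTo-cong (suc n) (λ i → *-distribˡ-sumTo (u i) _ (suc (n ∸ i))) ⟩
    sumTo (λ i → sumTo (λ j → u i * (v j * w (n ∸ i ∸ j))) (suc (n ∸ i))) (suc n)
      ≈⟨ sumTo-triangle (λ i j → u i * (v j * w (n ∸ i ∸ j))) n ⟩
    sumTo (λ j → sumTo (λ i → u i * (v j * w (n ∸ i ∸ j))) (suc (n ∸ j))) (suc n)
      ≈⟨ sumTo-cong (suc n) (λ j → sumTo-cong (suc (n ∸ j)) (λ i →
           trans (x*[y*z]≈y*[x*z] (u i) (v j) _) (*-congˡ (*-congˡ (reflexive (cong w (m∸n∸o≡m∸o∸n n i j))))))) ⟩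
    sumTo (λ j → sumTo (λ i → v j * (u i * w (n ∸ j ∸ i))) (suc (n ∸ j))) (suc n)
      ≈⟨ sumTo-cong (suc n) (λ j → *-distribˡ-sumTo (v j) _ (suc (n ∸ j))) ⟨
    sumTo (λ j → v j * sumTo (λ i → u i * w (n ∸ j ∸ i)) (suc (n ∸ j))) (suc n) ∎
    where
    m∸n∸o≡m∸o∸n : ∀ m n o → m ∸ n ∸ o ≡ m ∸ o ∸ n
    m∸n∸o≡m∸o∸n m n o = ≡.trans (ℕₚ.∸-+-assoc m n o) (≡.trans (cong (m ∸_) (ℕₚ.+-comm n o)) (≡.sym (ℕₚ.∸-+-assoc m o n)))

  mulPS-assoc : ∀ u v w → mulPS (mulPS u v) w ≐ mulPS u (mulPS v w)
  mulPS-assoc u v w n = begin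
    mulPS (mulPS u v) w n ≈⟨ mulPS-comm (mulPS u v) w n ⟩
    mulPS w (mulPS u v) n ≈⟨ mulPS-lcomm w u v n ⟩
    mulPS u (mulPS w v) n ≈⟨ mulPS-cong (λ _ → refl) (mulPS-comm w v) n ⟩
    mulPS u (mulPS v w) n ∎

  mulPS-identityˡ : ∀ v → mulPS onePS v ≐ v
  mulPS-identityˡ v n = begin
    mulPS onePS v n                                      ≈⟨ sumTo-suc _ n ⟩
    1# * v n + sumTo (λ i → 0# * v (n ∸ suc i)) n        ≈⟨ +-cong (*-identityˡ _) (sumTo-≈0 n (λ i _ → zeroˡ _)) ⟩
    v n + 0#                                             ≈⟨ +-identityʳ _ ⟩
    v n                                                  ∎

  mulPS-identityʳ : ∀ v → mulPS v onePS ≐ v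
  mulPS-identityʳ v n = trans (mulPS-comm v onePS n) (mulPS-identityˡ v n)

  mulPS-commutativeMonoid : CommutativeMonoid c ℓ
  mulPS-commutativeMonoid = record
    { Carrier             = ℕ → Carrier
    ; _≈_                 = _≐_
    ; _∙_                 = mulPS
    ; ε                   = onePS
    ; isCommutativeMonoid = record
      { isMonoid = record
        { isSemigroup = record
          { isMagma = record
            { isEquivalence = record
              { refl  = λ _ → refl
              ; sym   = λ u≐v n → sym (u≐v n)
              ; trans = λ u≐v v≐w n → trans (u≐v n) (v≐w n)
              }
            ; ∙-cong = mulPS-cong
            }
          ; assoc = mulPS-assoc
          }
        ; identity = mulPS-identityˡ , mulPS-identityʳ
        }
      ; comm = mulPS-comm
      }
    }

  open IntegerPowers mulPS-commutativeMonoid using (_^_; powℤ; powℤ-+)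

  powPS≐^ : ∀ v n → powPS v n ≐ v ^ n
  powPS≐^ v zero    _ = refl
  powPS≐^ v (suc n)   = mulPS-cong (λ _ → refl) (powPS≐^ v n)

  infix 4 _≐X^_·_
  record _≐X^_·_ (v : ℕ → Carrier) (j : ℕ) (w : ℕ → Carrier) : Set ℓ where
    field
      coeff-+ : ∀ i → v (j ℕ.+ i) ≈ w i
      coeff-< : ∀ i → i ℕ.< j → v i ≈ 0#
  open _≐X^_·_

  XPS≐X^1·onePS : XPS ≐X^ 1 · onePS
  XPS≐X^1·onePS = record
    { coeff-+ = λ { zero → refl ; (suc i) → refl }
    ; coeff-< = λ { zero _ → refl ; (suc _) (s≤s ()) }
    }

  mulPS-≐X^ : ∀ {v j w} → v ≐X^ j · w → ∀ x i → mulPS v x (j ℕ.+ i) ≈ mulPS w x i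
  mulPS-≐X^ {v} {j} {w} v≐X^jw x i = begin
    sumTo (λ l → v l * x (j ℕ.+ i ∸ l)) (suc (j ℕ.+ i))
      ≡⟨ cong (sumTo _) (≡.sym (ℕₚ.+-suc j i)) ⟩
    sumTo (λ l → v l * x (j ℕ.+ i ∸ l)) (j ℕ.+ suc i)
      ≈⟨ sumTo-split _ j (suc i) ⟩
    sumTo (λ l → v l * x (j ℕ.+ i ∸ l)) j + sumTo (λ l → v (j ℕ.+ l) * x (j ℕ.+ i ∸ (j ℕ.+ l))) (suc i)
      ≈⟨ +-cong (sumTo-≈0 j (λ l l<j → trans (*-congʳ (coeff-< v≐X^jw l l<j)) (zeroˡ _)))
                (sumTo-cong (suc i) (λ l →
                  *-cong (coeff-+ v≐X^jw l) (reflexive (cong x (ℕₚ.[m+n]∸[m+o]≡n∸o j i l))))) ⟩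
    0# + mulPS w x i
      ≈⟨ +-identityˡ _ ⟩
    mulPS w x i ∎

  ≐X^-mulPS : ∀ {v a w v′ b w′} → v ≐X^ a · w → v′ ≐X^ b · w′ → mulPS v v′ ≐X^ (a ℕ.+ b) · mulPS w w′
  ≐X^-mulPS {v} {a} {w} {v′} {b} {w′} v≐ v′≐ = record { coeff-+ = shifted ; coeff-< = low }
    where
    shifted : ∀ i → mulPS v v′ (a ℕ.+ b ℕ.+ i) ≈ mulPS w w′ i
    shifted i = begin
      mulPS v v′ (a ℕ.+ b ℕ.+ i)   ≡⟨ cong (mulPS v v′) (ℕₚ.+-assoc a b i) ⟩
      mulPS v v′ (a ℕ.+ (b ℕ.+ i)) ≈⟨ mulPS-≐X^ v≐ v′ (b ℕ.+ i) ⟩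
      mulPS w v′ (b ℕ.+ i)         ≈⟨ mulPS-comm w v′ (b ℕ.+ i) ⟩
      mulPS v′ w (b ℕ.+ i)         ≈⟨ mulPS-≐X^ v′≐ w i ⟩
      mulPS w′ w i                 ≈⟨ mulPS-comm w′ w i ⟩
      mulPS w w′ i                 ∎
    low : ∀ i → i ℕ.< a ℕ.+ b → mulPS v v′ i ≈ 0#
    low i i<a+b = sumTo-≈0 (suc i) term≈0
      where
      term≈0 : ∀ l → l ℕ.< suc i → v l * v′ (i ∸ l) ≈ 0#
      term≈0 l l<1+i with l ℕₚ.<? a
      ... | yes l<a = trans (*-congʳ (coeff-< v≐ l l<a)) (zeroˡ _)
      ... | no  l≮a = trans (*-congˡ (coeff-< v′≐ (i ∸ l) i-l<b)) (zeroʳ _)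
        where
        i<l+b : i ℕ.< l ℕ.+ b
        i<l+b = ℕₚ.<-≤-trans i<a+b (ℕₚ.+-monoˡ-≤ b (ℕₚ.≮⇒≥ l≮a))
        i-l<b : i ∸ l ℕ.< b
        i-l<b = ≡.subst (i ∸ l ℕ.<_) (ℕₚ.m+n∸m≡n l b) (ℕₚ.∸-monoˡ-< i<l+b (ℕₚ.≤-pred l<1+i))

  powPS-≐X^ : ∀ {v w} → v ≐X^ 1 · w → ∀ j → powPS v j ≐X^ j · powPS w j
  powPS-≐X^ v≐ zero    = record { coeff-+ = λ _ → refl ; coeff-< = λ _ () }
  powPS-≐X^ v≐ (suc j) = ≐X^-mulPS v≐ (powPS-≐X^ v≐ j)

  invUpTo-stable : ∀ v {m k} → k ℕ.≤ m → invUpTo v m k ≡ invPS v k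
  invUpTo-stable v {zero}  z≤n  = ≡.refl
  invUpTo-stable v {suc m} k≤1+m with ℕₚ.m≤n⇒m<n∨m≡n k≤1+m
  ... | inj₁ k<1+m  = ≡.trans (if-true (ℕₚ.≤⇒≤ᵇ (ℕₚ.≤-pred k<1+m))) (invUpTo-stable v (ℕₚ.≤-pred k<1+m))
  ... | inj₂ ≡.refl = ≡.refl

  invPS-suc : ∀ v m → invPS v (suc m) ≡ - (v 0 ⁻¹) * sumTo (λ j → v (suc j) * invUpTo v m (m ∸ j)) (suc m)
  invPS-suc v m = ≡.trans (if-false (λ t → ℕₚ.<-irrefl ≡.refl (ℕₚ.≤ᵇ⇒≤ (suc m) m t))) (if-true (ℕₚ.≡⇒≡ᵇ m m ≡.refl))

  mulPS-invPS : ∀ v → v 0 ≉ 0# → mulPS v (invPS v) ≐ onePS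
  mulPS-invPS v v₀≉0 zero    = trans (+-identityˡ _) (⁻¹-inverse (v 0) v₀≉0)
  mulPS-invPS v v₀≉0 (suc m) = begin
    mulPS v (invPS v) (suc m)       ≈⟨ sumTo-suc _ (suc m) ⟩
    v 0 * invPS v (suc m) + S       ≡⟨ cong (λ x → v 0 * x + S) (invPS-suc v m) ⟩
    v 0 * (- (v 0 ⁻¹) * S′) + S     ≈⟨ +-congʳ (*-congˡ (*-congˡ S′≈S)) ⟩
    v 0 * (- (v 0 ⁻¹) * S) + S      ≈⟨ +-congʳ (*-congˡ (-‿distribˡ-* _ S)) ⟨
    v 0 * - (v 0 ⁻¹ * S) + S        ≈⟨ +-congʳ (-‿distribʳ-* (v 0) _) ⟨
    - (v 0 * (v 0 ⁻¹ * S)) + S      ≈⟨ +-congʳ (-‿cong (*-assoc _ _ S)) ⟨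
    - (v 0 * v 0 ⁻¹ * S) + S        ≈⟨ +-congʳ (-‿cong (trans (*-congʳ (⁻¹-inverse (v 0) v₀≉0)) (*-identityˡ S))) ⟩
    - S + S                         ≈⟨ -‿inverseˡ S ⟩
    0#                              ∎
    where
    S S′ : Carrier
    S  = sumTo (λ j → v (suc j) * invPS v (m ∸ j)) (suc m)
    S′ = sumTo (λ j → v (suc j) * invUpTo v m (m ∸ j)) (suc m)
    S′≈S : S′ ≈ S
    S′≈S = sumTo-cong (suc m) (λ j → *-congˡ (reflexive (invUpTo-stable v (ℕₚ.m∸n≤m m j))))

  natFact-≉0 : ∀ n → natFact n ≉ 0#
  natFact-≉0 zero    = 1≉0
  natFact-≉0 (suc n) = *-≉0 (natFact-≉0 n) (charZero n)

  signPow-≉0 : ∀ n → signPow n ≉ 0#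
  signPow-≉0 zero    = 1≉0
  signPow-≉0 (suc n) = -‿≉0 (signPow-≉0 n)

  fact-≉0 : ∀ k → fact k ≉ 0#
  fact-≉0 (+ n)    = natFact-≉0 n
  fact-≉0 -[1+ n ] = *-≉0 (signPow-≉0 n) (⁻¹-≉0 (natFact-≉0 n))

  fact≈fl*fact[k-1] : ∀ k → fact k ≈ fl k * fact (k ℤ.- + 1)
  fact≈fl*fact[k-1] (+ zero)  = sym (trans (*-identityˡ _) (trans (*-identityˡ _) 1⁻¹≈1))
  fact≈fl*fact[k-1] (+ suc n) = *-comm _ _
  fact≈fl*fact[k-1] -[1+ n ] rewrite ℕₚ.+-identityʳ n = begin
    s * N ⁻¹                     ≈⟨ *-congˡ (⁻¹-unique (natFact-≉0 n) ιₙ*[N*ιₙ]⁻¹*N≈1) ⟨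
    s * (ιₙ * (N * ιₙ) ⁻¹)       ≈⟨ x*[y*z]≈y*[x*z] s ιₙ _ ⟩
    ιₙ * (s * (N * ιₙ) ⁻¹)       ≈⟨ -x*[-y*z]≈x*[y*z] ιₙ s _ ⟨
    - ιₙ * (- s * (N * ιₙ) ⁻¹)   ∎
    where
    s N ιₙ : Carrier
    s  = signPow n
    N  = natFact n
    ιₙ = ι R (suc n)
    ιₙ*[N*ιₙ]⁻¹*N≈1 : (ιₙ * (N * ιₙ) ⁻¹) * N ≈ 1#
    ιₙ*[N*ιₙ]⁻¹*N≈1 = trans ([x*y]*z≈[z*x]*y ιₙ _ N) (⁻¹-inverse (N * ιₙ) (*-≉0 (natFact-≉0 n) (charZero n)))
    -x*[-y*z]≈x*[y*z] : ∀ x y z → - x * (- y * z) ≈ x * (y * z)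
    -x*[-y*z]≈x*[y*z] x y z = begin
      - x * (- y * z)     ≈⟨ -‿distribˡ-* x _ ⟨
      - (x * (- y * z))   ≈⟨ -‿cong (*-congˡ (-‿distribˡ-* y z)) ⟨
      - (x * - (y * z))   ≈⟨ -‿cong (-‿distribʳ-* x _) ⟨
      - - (x * (y * z))   ≈⟨ -‿involutive _ ⟩
      x * (y * z)         ∎

  fl*fact⁻¹≈fact[k-1]⁻¹ : ∀ k → fl k * fact k ⁻¹ ≈ fact (k ℤ.- + 1) ⁻¹
  fl*fact⁻¹≈fact[k-1]⁻¹ k = ⁻¹-unique (fact-≉0 (k ℤ.- + 1)) (begin
    (fl k * fact k ⁻¹) * fact (k ℤ.- + 1) ≈⟨ [x*y]*z≈y*[x*z] (fl k) _ _ ⟩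
    fact k ⁻¹ * (fl k * fact (k ℤ.- + 1)) ≈⟨ *-congˡ (fact≈fl*fact[k-1] k) ⟨
    fact k ⁻¹ * fact k                    ≈⟨ ⁻¹-inverseˡ (fact-≉0 k) ⟩
    1#                                    ∎)

  record IsLowerTriangularSolution (f : ℕ → Carrier) (T : ℤ → ℤ → Carrier) : Set ℓ where
    field
      vanishes-above : ∀ k m → k < m → T k m ≈ 0#
      recurrence     : ∀ m n → sumTo (λ j → f j * T (m ℤ.+ + n) (m ℤ.+ + j)) (suc n) ≈ T (m ℤ.+ + n ℤ.- + 1) m
  open IsLowerTriangularSolution public

  solution-difference : ∀ {f X Y} → IsLowerTriangularSolution f X → IsLowerTriangularSolution f Y →
                        IsLowerTriangularSolution f (λ k m → X k m - Y k m)
  solution-difference {f} {X} {Y} X-sol Y-sol = record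
    { vanishes-above = λ k m k<m → trans (+-cong (vanishes-above X-sol k m k<m) (-‿cong (vanishes-above Y-sol k m k<m)))
                                         (trans (+-identityˡ _) -0#≈0#)
    ; recurrence     = λ m n → begin
        sumTo (λ j → f j * (X (m ℤ.+ + n) (m ℤ.+ + j) - Y (m ℤ.+ + n) (m ℤ.+ + j))) (suc n)
          ≈⟨ sumTo-cong (suc n) (λ j → x[y-z]≈xy-xz (f j) _ _) ⟩
        sumTo (λ j → f j * X (m ℤ.+ + n) (m ℤ.+ + j) - f j * Y (m ℤ.+ + n) (m ℤ.+ + j)) (suc n)
          ≈⟨ sumTo-difference _ _ (suc n) ⟩
        sumTo (λ j → f j * X (m ℤ.+ + n) (m ℤ.+ + j)) (suc n) - sumTo (λ j → f j * Y (m ℤ.+ + n) (m ℤ.+ + j)) (suc n)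
          ≈⟨ +-cong (recurrence X-sol m n) (-‿cong (recurrence Y-sol m n)) ⟩
        X (m ℤ.+ + n ℤ.- + 1) m - Y (m ℤ.+ + n ℤ.- + 1) m ∎
    }

  ≈0-propagates : ∀ {x} (a : ℤ → Carrier) → x ≉ 0# → (∀ m → x * a (+ 1 ℤ.+ m) ≈ a m) →
                  a (+ 0) ≈ 0# → ∀ m → a m ≈ 0#
  ≈0-propagates a x≉0 step a₀≈0 (+ zero)      = a₀≈0
  ≈0-propagates a x≉0 step a₀≈0 (+ suc n)     =
    x≉0∧x*y≈0⇒y≈0 x≉0 (trans (step (+ n)) (≈0-propagates a x≉0 step a₀≈0 (+ n)))
  ≈0-propagates a x≉0 step a₀≈0 -[1+ zero ]   = trans (sym (step -[1+ 0 ])) (trans (*-congˡ a₀≈0) (zeroʳ _))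
  ≈0-propagates a x≉0 step a₀≈0 -[1+ suc n ]  =
    trans (sym (step -[1+ suc n ])) (trans (*-congˡ (≈0-propagates a x≉0 step a₀≈0 -[1+ n ])) (zeroʳ _))

  module _ {f : ℕ → Carrier} (f₀≈0 : f 0 ≈ 0#) (f₁≉0 : f 1 ≉ 0#) where

    solution-≈0 : ∀ {E} → IsLowerTriangularSolution f E → (∀ k → E k (+ 0) ≈ 0#) → ∀ k m → E k m ≈ 0#
    solution-≈0 {E} E-sol column≈0 k m with <⊎≡+ k m
    ... | inj₁ k<m          = vanishes-above E-sol k m k<m
    ... | inj₂ (n , ≡.refl) = <-rec Diagonal≈0 diagonal≈0 n m
      where
      Diagonal≈0 : ℕ → Set ℓ
      Diagonal≈0 n = ∀ m → E (m ℤ.+ + n) m ≈ 0#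

      diagonal≈0 : ∀ n → (∀ {d} → d ℕ.< n → Diagonal≈0 d) → Diagonal≈0 n
      diagonal≈0 n nearer≈0 = ≈0-propagates (λ m → E (m ℤ.+ + n) m) f₁≉0 step (column≈0 (+ n))
        where
        step : ∀ m → f 1 * E ((+ 1 ℤ.+ m) ℤ.+ + n) (+ 1 ℤ.+ m) ≈ E (m ℤ.+ + n) m
        step m = begin
          f 1 * E ((+ 1 ℤ.+ m) ℤ.+ + n) (+ 1 ℤ.+ m)
            ≡⟨ ≡.cong₂ (λ k l → f 1 * E k l) (≡.sym (m+[1+n]≡[1+m]+n m (+ n))) (ℤₚ.+-comm (+ 1) m) ⟩
          h 1
            ≈⟨ sumTo≈term₁ n (trans (*-congʳ f₀≈0) (zeroˡ _)) h[2+i]≈0 ⟨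
          sumTo h (2 ℕ.+ n)
            ≈⟨ recurrence E-sol m (suc n) ⟩
          E (m ℤ.+ + suc n ℤ.- + 1) m
            ≡⟨ cong (λ k → E k m) (m+[1+n]-1≡m+n m (+ n)) ⟩
          E (m ℤ.+ + n) m ∎
          where
          h : ℕ → Carrier
          h j = f j * E (m ℤ.+ + suc n) (m ℤ.+ + j)
          h[2+i]≈0 : ∀ i → i ℕ.< n → h (2 ℕ.+ i) ≈ 0#
          h[2+i]≈0 i i<n = trans (*-congˡ (trans (reflexive (cong (λ k → E k (m ℤ.+ + (2 ℕ.+ i))) row))
                                                 (nearer≈0 (ℕₚ.∸-monoʳ-< (s≤s z≤n) i<n) _)))
                                 (zeroʳ _)
            where
            row : m ℤ.+ + suc n ≡ (m ℤ.+ + (2 ℕ.+ i)) ℤ.+ + (n ∸ suc i)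
            row = ≡.trans (cong (λ l → m ℤ.+ + suc l) (≡.sym (ℕₚ.m+[n∸m]≡n i<n))) (≡.sym (ℤₚ.+-assoc m _ _))

    solutions-unique : ∀ {X Y} → IsLowerTriangularSolution f X → IsLowerTriangularSolution f Y →
                       (∀ k → X k (+ 0) ≈ Y k (+ 0)) → ∀ k m → X k m ≈ Y k m
    solutions-unique X-sol Y-sol same-column k m =
      x-y≈0⇒x≈y _ _ (solution-≈0 (solution-difference X-sol Y-sol) (λ k → x≈y⇒x-y≈0 (same-column k)) k m)

  coeffTable : (ℤ → ℤ → Carrier) → ℤ → ℤ → Carrier
  coeffTable p k m = p k m * fact m * fact k ⁻¹

  rhsCoeff≈coeffTable : ∀ p m k → rhsCoeff p m k ≈ coeffTable p k m
  rhsCoeff≈coeffTable p m k = begin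
    p k (+ 0 ℤ.+ m) * (fact (+ 0 ℤ.+ m) * 1# ⁻¹) * fact k ⁻¹
      ≡⟨ cong (λ l → p k l * (fact l * 1# ⁻¹) * fact k ⁻¹) (ℤₚ.+-identityˡ m) ⟩
    p k m * (fact m * 1# ⁻¹) * fact k ⁻¹
      ≈⟨ *-congʳ (*-congˡ (trans (*-congˡ 1⁻¹≈1) (*-identityʳ _))) ⟩
    coeffTable p k m ∎

  module _ {f : ℕ → Carrier} {p : ℤ → ℤ → Carrier}
           (deg-p : ∀ a b → a < b → p a b ≈ 0#)
           (⟨p₀⟩≈1 : bracket (p (+ 0)) ≈ 1#)
           (⟨pₐ⟩≈0 : ∀ a → ¬ (a ≡ + 0) → bracket (p a) ≈ 0#)
           (f[pₐ]≈⌊a⌉pₐ₋₁ : ∀ a m → applyOp f a (p a) m ≈ fl a * p (a ℤ.- + 1) m) where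

    coeffTable-column : ∀ k → coeffTable p k (+ 0) ≈ embed onePS k
    coeffTable-column (+ zero)      = trans (*-cong (trans (*-identityʳ _) ⟨p₀⟩≈1) 1⁻¹≈1) (*-identityʳ 1#)
    coeffTable-column k@(+ suc _)   = trans (*-congʳ (trans (*-identityʳ _) (⟨pₐ⟩≈0 k (λ ())))) (zeroˡ _)
    coeffTable-column k@(-[1+ _ ])  = trans (*-congʳ (trans (*-identityʳ _) (⟨pₐ⟩≈0 k (λ ())))) (zeroˡ _)

    coeffTable-solution : IsLowerTriangularSolution f (coeffTable p)
    coeffTable-solution = record
      { vanishes-above = λ k m k<m → trans (*-congʳ (trans (*-congʳ (deg-p k m k<m)) (zeroˡ _))) (zeroˡ _)
      ; recurrence     = recurrence′
      }
      where
      recurrence′ : ∀ m n → sumTo (λ j → f j * coeffTable p (m ℤ.+ + n) (m ℤ.+ + j)) (suc n) ≈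
                            coeffTable p (m ℤ.+ + n ℤ.- + 1) m
      recurrence′ m n = begin
        sumTo (λ j → f j * coeffTable p k (m ℤ.+ + j)) (suc n)
          ≈⟨ sumTo-cong (suc n) (λ j → rescale (f j) _ _) ⟩
        sumTo (λ j → f j * Dpow (+ j) (p k) m * (fact m * fact k ⁻¹)) (suc n)
          ≈⟨ *-distribʳ-sumTo _ _ (suc n) ⟨
        sumTo (λ j → f j * Dpow (+ j) (p k) m) (suc n) * (fact m * fact k ⁻¹)
          ≡⟨ cong (λ l → sumTo (λ j → f j * Dpow (+ j) (p k) m) (suc ℤ.∣ l ∣) * (fact m * fact k ⁻¹))
                  (≡.sym (m+n-m≡n m (+ n))) ⟩
        applyOp f k (p k) m * (fact m * fact k ⁻¹)
          ≈⟨ *-congʳ (trans (f[pₐ]≈⌊a⌉pₐ₋₁ k m) (*-comm _ _)) ⟩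
        p (k ℤ.- + 1) m * fl k * (fact m * fact k ⁻¹)
          ≈⟨ *-interchange _ _ _ _ ⟩
        p (k ℤ.- + 1) m * fact m * (fl k * fact k ⁻¹)
          ≈⟨ *-congˡ (fl*fact⁻¹≈fact[k-1]⁻¹ k) ⟩
        coeffTable p (k ℤ.- + 1) m ∎
        where
        k : ℤ
        k = m ℤ.+ + n
        rescale : ∀ x P F′ → x * (P * F′ * fact k ⁻¹) ≈ x * (P * (F′ * fact m ⁻¹)) * (fact m * fact k ⁻¹)
        rescale x P F′ = begin
          x * (P * F′ * fact k ⁻¹)                              ≈⟨ *-assoc x _ _ ⟨
          x * (P * F′) * fact k ⁻¹                              ≈⟨ x*y⁻¹*[y*z]≈x*z _ _ (fact-≉0 m) ⟨
          x * (P * F′) * fact m ⁻¹ * (fact m * fact k ⁻¹)       ≈⟨ *-congʳ (trans (*-assoc x _ _) (*-congˡ (*-assoc P F′ _))) ⟩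
          x * (P * (F′ * fact m ⁻¹)) * (fact m * fact k ⁻¹)     ∎

  powerTable : (ℕ → Carrier) → ℤ → ℤ → Carrier
  powerTable g k m = gpow g m k

  embed-<0 : ∀ h {z} → z < + 0 → embed h z ≈ 0#
  embed-<0 h {+ _}      (ℤ.+<+ ())
  embed-<0 h { -[1+ _ ]} _ = refl

  module _ {f g : ℕ → Carrier} (f₀≈0 : f 0 ≈ 0#) (g₀≈0 : g 0 ≈ 0#) (f∘g≐X : compPS f g ≐ XPS) where

    u : ℕ → Carrier
    u i = g (suc i)

    g^j≐X^j·u^j : ∀ j → powPS g j ≐X^ j · powPS u j
    g^j≐X^j·u^j = powPS-≐X^ (record { coeff-+ = λ _ → refl ; coeff-< = λ { zero _ → g₀≈0 ; (suc _) (s≤s ()) } })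

    -- Since f₀ = 0, the coefficient of X in f(g) = X is f₁ g₁ = f₁ u₀.
    u₀≉0 : u 0 ≉ 0#
    u₀≉0 u₀≈0 = 1≉0 (trans (sym (f∘g≐X 1)) (sumTo-≈0 2 f[j]*g^j[1]≈0))
      where
      f[j]*g^j[1]≈0 : ∀ j → j ℕ.< 2 → f j * powPS g j 1 ≈ 0#
      f[j]*g^j[1]≈0 zero          _ = trans (*-congʳ f₀≈0) (zeroˡ _)
      f[j]*g^j[1]≈0 (suc zero)    _ =
        trans (*-congˡ (trans (coeff-+ (g^j≐X^j·u^j 1) 0) (trans (mulPS-identityʳ u 0) u₀≈0))) (zeroʳ _)
      f[j]*g^j[1]≈0 (suc (suc _)) (s≤s (s≤s ()))

    u*u⁻¹≐1 : mulPS u (invPS u) ≐ onePS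
    u*u⁻¹≐1 = mulPS-invPS u u₀≉0

    u^ℤ : ℤ → ℕ → Carrier
    u^ℤ = powℤ {u} {invPS u} u*u⁻¹≐1

    powerTable-diagonal : ∀ m n → powerTable g (m ℤ.+ + n) m ≈ u^ℤ m n
    powerTable-diagonal (+ m)    n = trans (coeff-+ (g^j≐X^j·u^j m) n) (powPS≐^ u m n)
    powerTable-diagonal -[1+ m ] n = trans (reflexive (cong (embed (powPS (invPS u) (suc m))) (m+n-m≡n -[1+ m ] (+ n))))
                                           (powPS≐^ (invPS u) (suc m) n)

    powerTable-above : ∀ k m → k < m → powerTable g k m ≈ 0#
    powerTable-above (+ k)    (+ m)    (ℤ.+<+ k<m) = coeff-< (g^j≐X^j·u^j m) k k<m
    powerTable-above -[1+ _ ] (+ m)    _           = refl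
    powerTable-above k        -[1+ m ] k<m         =
      embed-<0 _ (≡.subst (k ℤ.+ + suc m <_) (ℤₚ.+-inverseˡ (+ suc m)) (ℤₚ.+-monoˡ-< (+ suc m) k<m))

    truncated-f∘g≈X : ∀ n i → i ℕ.≤ n → sumTo (λ j → f j * powPS g j i) (suc n) ≈ XPS i
    truncated-f∘g≈X n i i≤n = begin
      sumTo h (suc n)
        ≡⟨ cong (λ l → sumTo h (suc l)) (≡.sym (ℕₚ.m+[n∸m]≡n i≤n)) ⟩
      sumTo h (suc i ℕ.+ (n ∸ i))
        ≈⟨ sumTo-split h (suc i) (n ∸ i) ⟩
      sumTo h (suc i) + sumTo (λ l → h (suc i ℕ.+ l)) (n ∸ i)
        ≈⟨ +-congˡ (sumTo-≈0 (n ∸ i) (λ l _ → h[1+i+l]≈0 l)) ⟩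
      compPS f g i + 0#
        ≈⟨ trans (+-identityʳ _) (f∘g≐X i) ⟩
      XPS i ∎
      where
      h : ℕ → Carrier
      h j = f j * powPS g j i
      h[1+i+l]≈0 : ∀ l → h (suc i ℕ.+ l) ≈ 0#
      h[1+i+l]≈0 l = trans (*-congˡ (coeff-< (g^j≐X^j·u^j (suc i ℕ.+ l)) i (s≤s (ℕₚ.m≤m+n i l)))) (zeroʳ _)

    truncated-f∘g*w≈X*w : ∀ w n → sumTo (λ j → f j * mulPS (powPS g j) w n) (suc n) ≈ mulPS XPS w n
    truncated-f∘g*w≈X*w w n = begin
      sumTo (λ j → f j * sumTo (λ i → powPS g j i * w (n ∸ i)) (suc n)) (suc n)
        ≈⟨ sumTo-cong (suc n) (λ j → *-distribˡ-sumTo (f j) _ (suc n)) ⟩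
      sumTo (λ j → sumTo (λ i → f j * (powPS g j i * w (n ∸ i))) (suc n)) (suc n)
        ≈⟨ sumTo-comm _ (suc n) (suc n) ⟩
      sumTo (λ i → sumTo (λ j → f j * (powPS g j i * w (n ∸ i))) (suc n)) (suc n)
        ≈⟨ sumTo-cong (suc n) (λ i → trans (sumTo-cong (suc n) (λ j → sym (*-assoc _ _ _)))
                                           (sym (*-distribʳ-sumTo _ _ (suc n)))) ⟩
      sumTo (λ i → sumTo (λ j → f j * powPS g j i) (suc n) * w (n ∸ i)) (suc n)
        ≈⟨ sumTo-cong< (suc n) (λ i i<1+n → *-congʳ (truncated-f∘g≈X n i (ℕₚ.≤-pred i<1+n))) ⟩
      mulPS XPS w n ∎

    X*u^ℤ≈powerTable : ∀ m n → mulPS XPS (u^ℤ m) n ≈ powerTable g (m ℤ.+ + n ℤ.- + 1) m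
    X*u^ℤ≈powerTable m zero    = trans (+-identityˡ _) (trans (zeroˡ _) (sym (powerTable-above _ m m+0-1<m)))
      where
      m+0-1<m : m ℤ.+ + 0 ℤ.- + 1 < m
      m+0-1<m = ℤₚ.i≤pred[j]⇒i<j (ℤₚ.≤-reflexive (m+0-1≡pred[m] m))
    X*u^ℤ≈powerTable m (suc n) = begin
      mulPS XPS (u^ℤ m) (1 ℕ.+ n)         ≈⟨ mulPS-≐X^ XPS≐X^1·onePS (u^ℤ m) n ⟩
      mulPS onePS (u^ℤ m) n               ≈⟨ mulPS-identityˡ (u^ℤ m) n ⟩
      u^ℤ m n                             ≈⟨ powerTable-diagonal m n ⟨
      powerTable g (m ℤ.+ + n) m          ≡⟨ cong (λ k → powerTable g k m) (≡.sym (m+[1+n]-1≡m+n m (+ n))) ⟩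
      powerTable g (m ℤ.+ + suc n ℤ.- + 1) m ∎

    powerTable-solution : IsLowerTriangularSolution f (powerTable g)
    powerTable-solution = record { vanishes-above = powerTable-above ; recurrence = recurrence′ }
      where
      entry : ∀ m {n j} → j ℕ.≤ n → powerTable g (m ℤ.+ + n) (m ℤ.+ + j) ≈ mulPS (powPS g j) (u^ℤ m) n
      entry m {n} {j} j≤n = begin
        powerTable g (m ℤ.+ + n) (m ℤ.+ + j)
          ≡⟨ cong (λ k → powerTable g k (m ℤ.+ + j)) row ⟩
        powerTable g (m ℤ.+ + j ℤ.+ + (n ∸ j)) (m ℤ.+ + j)
          ≈⟨ powerTable-diagonal (m ℤ.+ + j) (n ∸ j) ⟩
        u^ℤ (m ℤ.+ + j) (n ∸ j)
          ≈⟨ powℤ-+ {u} {invPS u} u*u⁻¹≐1 m j (n ∸ j) ⟩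
        mulPS (u ^ j) (u^ℤ m) (n ∸ j)
          ≈⟨ mulPS-cong {v = u^ℤ m} (powPS≐^ u j) (λ _ → refl) (n ∸ j) ⟨
        mulPS (powPS u j) (u^ℤ m) (n ∸ j)
          ≈⟨ mulPS-≐X^ (g^j≐X^j·u^j j) (u^ℤ m) (n ∸ j) ⟨
        mulPS (powPS g j) (u^ℤ m) (j ℕ.+ (n ∸ j))
          ≡⟨ cong (mulPS (powPS g j) (u^ℤ m)) (ℕₚ.m+[n∸m]≡n j≤n) ⟩
        mulPS (powPS g j) (u^ℤ m) n ∎
        where
        row : m ℤ.+ + n ≡ m ℤ.+ + j ℤ.+ + (n ∸ j)
        row = ≡.trans (cong (λ l → m ℤ.+ + l) (≡.sym (ℕₚ.m+[n∸m]≡n j≤n))) (≡.sym (ℤₚ.+-assoc m _ _))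

      recurrence′ : ∀ m n → sumTo (λ j → f j * powerTable g (m ℤ.+ + n) (m ℤ.+ + j)) (suc n) ≈
                            powerTable g (m ℤ.+ + n ℤ.- + 1) m
      recurrence′ m n = begin
        sumTo (λ j → f j * powerTable g (m ℤ.+ + n) (m ℤ.+ + j)) (suc n)
          ≈⟨ sumTo-cong< (suc n) (λ j j<1+n → *-congˡ (entry m (ℕₚ.≤-pred j<1+n))) ⟩
        sumTo (λ j → f j * mulPS (powPS g j) (u^ℤ m) n) (suc n)
          ≈⟨ truncated-f∘g*w≈X*w (u^ℤ m) n ⟩
        mulPS XPS (u^ℤ m) n
          ≈⟨ X*u^ℤ≈powerTable m n ⟩
        powerTable g (m ℤ.+ + n ℤ.- + 1) m ∎

mainTheorem18 : ∀ {c ℓ} (R : CommutativeRing c ℓ) (F : IsCharZeroField R) →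
    let open CommutativeRing R
        open Umbral R F
    in (f : ℕ → Carrier) → f 0 ≈ 0# → ¬ (f 1 ≈ 0#) →
       (g : ℕ → Carrier) → IsCompInverse f g →
       (p : ℤ → ℤ → Carrier) → IsAssocGradedSeq f p →
       (a : ℤ) →
         (∃[ N ] (∀ k → k < N → rhsCoeff p a k ≈ 0#))
       × (∀ k → gpow g a k ≈ rhsCoeff p a k)
mainTheorem18 R F f f₀≈0 f₁≉0 g (g₀≈0 , f∘g≐X , _) p (deg-p , _ , ⟨p₀⟩≈1 , ⟨pₐ⟩≈0 , f[pₐ]≈⌊a⌉pₐ₋₁) a =
    (a , λ k k<a → trans (rhsCoeff≈coeffTable p a k) (vanishes-above coefficients k a k<a))
  , λ k → sym (trans (rhsCoeff≈coeffTable p a k) (solutions-unique f₀≈0 f₁≉0 coefficients powers columns k a))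
  where
  open CommutativeRing R using (_≈_; sym; trans)
  open UmbralProperties R F

  coefficients : IsLowerTriangularSolution f (coeffTable p)
  coefficients = coeffTable-solution deg-p ⟨p₀⟩≈1 ⟨pₐ⟩≈0 f[pₐ]≈⌊a⌉pₐ₋₁

  powers : IsLowerTriangularSolution f (powerTable g)
  powers = powerTable-solution f₀≈0 g₀≈0 f∘g≐X

  columns : ∀ k → coeffTable p k (+ 0) ≈ powerTable g k (+ 0)
  columns = coeffTable-column deg-p ⟨p₀⟩≈1 ⟨pₐ⟩≈0 f[pₐ]≈⌊a⌉pₐ₋₁
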